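{- Let $\dot G$ be a connected unbalanced $C_3^-$-free signed graph, let $\mathcal C$ be an unbalanced cycle of $\dot G$ of minimum length, and let $uv$ be a negative edge of $\mathcal C$. Let $u_i$ be the neighbour of $u$ on $\mathcal C$ other than $v$, and $v_j$ the neighbour of $v$ on $\mathcal C$ other than $u$ (so $\mathcal C=uu_iv_jvu$ or $\mathcal C=uu_iz_1\cdots z_qv_jvu$). Then $u_i\in N[u]\setminus N[v]$ and $v_j\in N[v]\setminus N[u]$, i.e. $u_i$ is not adjacent to $v$ and $v_j$ is not adjacent to $u$.
   Context: A signed graph is a simple graph with each edge signed $+1$ or $-1$; the sign of a cycle is the product of its edge signs, and a cycle is unbalanced if its sign is $-1$. $C_3^-$-free means no triangle has sign $-1$. $N(x)$ is the set of neighbours of $x$ and $N[x]=N(x)\cup\{x\}$. -}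

module Defs where

open import Data.Nat using (ℕ; _≤_; _≥_)
open import Data.Fin using (Fin)
open import Data.List using (List; []; _∷_; _++_; [_]; length)
open import Data.List.Relation.Unary.Linked using (Linked)
open import Data.List.Relation.Unary.Unique.Propositional using (Unique)
open import Data.Product using (Σ; _×_; ∃)
open import Data.Sum using (_⊎_)
open import Relation.Nullary using (¬_)
open import Relation.Binary.PropositionalEquality using (_≡_)

data Sign : Set where
  pos neg : Sign

_·_ : Sign → Sign → Sign
pos · s = s
neg · pos = neg
neg · neg = pos

-- A finite simple signed graph on vertex set Fin n.
-- 'sign x y' is the sign of the edge xy; its value on non-edges is irrelevant.
record SignedGraph (n : ℕ) : Set₁ where
  field
    Adj       : Fin n → Fin n → Set
    Adj-sym   : ∀ {x y} → Adj x y → Adj y x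
    Adj-irrefl : ∀ {x} → ¬ Adj x x
    sign      : Fin n → Fin n → Sign
    sign-sym  : ∀ x y → sign x y ≡ sign y x

module _ {n : ℕ} (G : SignedGraph n) where
  open SignedGraph G

  data Walk : Fin n → Fin n → Set where
    here : ∀ {x} → Walk x x
    step : ∀ {x y z} → Adj x y → Walk y z → Walk x z

  Connected : Set
  Connected = ∀ x y → Walk x y

  closeUp : List (Fin n) → List (Fin n)
  closeUp []       = []
  closeUp (x ∷ xs) = x ∷ xs ++ [ x ]

  IsCycle : List (Fin n) → Set
  IsCycle C = length C ≥ 3 × Unique C × Linked Adj (closeUp C)

  pathSign : List (Fin n) → Sign
  pathSign []           = pos
  pathSign (x ∷ [])     = pos
  pathSign (x ∷ y ∷ xs) = sign x y · pathSign (y ∷ xs)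

  cycleSign : List (Fin n) → Sign
  cycleSign C = pathSign (closeUp C)

  UnbalancedCycle : List (Fin n) → Set
  UnbalancedCycle C = IsCycle C × cycleSign C ≡ neg

  Unbalanced : Set
  Unbalanced = ∃ λ C → UnbalancedCycle C

  C3⁻-free : Set
  C3⁻-free = ∀ C → IsCycle C → length C ≡ 3 → cycleSign C ≡ pos

  MinUnbalancedCycle : List (Fin n) → Set
  MinUnbalancedCycle C = UnbalancedCycle C × (∀ D → UnbalancedCycle D → length C ≤ length D)

  _∈N[_] : Fin n → Fin n → Set
  y ∈N[ x ] = y ≡ x ⊎ Adj x y

-- If uᵢ were adjacent to v, the triangle u uᵢ v would be positive
-- (C₃⁻-freeness), so replacing the path v u uᵢ of 𝒞 by the edge v uᵢ would
-- multiply the sign by that of the triangle and give an unbalanced cycle one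
-- shorter than 𝒞 (if 𝒞 is itself a triangle it cannot be unbalanced at all).
-- The claim for vⱼ is the same argument applied to 𝒞 rotated so that v
-- comes first.
module Submission where

open import Defs
open import Data.Nat using (ℕ; _≤_; s≤s)
open import Data.Nat.Properties using (1+n≰n; m≤n+m; ≤-refl)
open import Data.Fin using (Fin)
open import Data.List using (List; []; _∷_; _∷ʳ_; length)
open import Data.List.Properties using (length-++)
open import Data.List.Relation.Unary.All as All using ([]; _∷_)
open import Data.List.Relation.Unary.Any using (here)
open import Data.List.Relation.Unary.AllPairs using (_∷_; [])
open import Data.List.Relation.Unary.Linked using (Linked; [-]; _∷_)
open import Data.List.Relation.Unary.Unique.Propositional using (Unique)
open import Data.List.Membership.Propositional.Properties using (∈-++⁺ʳ)
open import Data.List.Relation.Binary.Permutation.Propositional using (_↭_; ↭-sym; ↭⇒↭ₛ)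
open import Data.List.Relation.Binary.Permutation.Propositional.Properties using (∷↭∷ʳ; ↭-length)
open import Data.List.Relation.Binary.Permutation.Setoid.Properties using (Unique-resp-↭)
open import Data.Product using (_×_; _,_; proj₁; proj₂; map₁)
open import Data.Sum using (inj₁; inj₂)
open import Function using (_∘_)
open import Relation.Nullary using (¬_)
open import Relation.Binary.PropositionalEquality
  using (_≡_; _≢_; refl; sym; trans; cong; cong₂; subst; setoid; module ≡-Reasoning)

·-assoc : ∀ a b c → (a · b) · c ≡ a · (b · c)
·-assoc pos b   c   = refl
·-assoc neg pos c   = refl
·-assoc neg neg pos = refl
·-assoc neg neg neg = refl

·-comm : ∀ a b → a · b ≡ b · a
·-comm pos pos = refl
·-comm pos neg = refl
·-comm neg pos = refl
·-comm neg neg = refl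

·-identityʳ : ∀ a → a · pos ≡ a
·-identityʳ pos = refl
·-identityʳ neg = refl

·-same : ∀ a → a · a ≡ pos
·-same pos = refl
·-same neg = refl

·-triangle : ∀ a b c p → a · (p · c) ≡ (a · (b · c)) · (p · b)
·-triangle a b c p = begin
  a · (p · c)               ≡⟨ cong (λ s → a · (p · (s · c))) (sym (·-same b)) ⟩
  a · (p · ((b · b) · c))   ≡⟨ cong (λ s → a · (p · s)) (·-assoc b b c) ⟩
  a · (p · (b · (b · c)))   ≡⟨ cong (a ·_) (sym (·-assoc p b (b · c))) ⟩
  a · ((p · b) · (b · c))   ≡⟨ cong (a ·_) (·-comm (p · b) (b · c)) ⟩
  a · ((b · c) · (p · b))   ≡⟨ sym (·-assoc a (b · c) (p · b)) ⟩
  (a · (b · c)) · (p · b)   ∎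
  where open ≡-Reasoning

module _ {A : Set} {R : A → A → Set} where

  Linked-∷ʳ⁻ : ∀ xs {y z} → Linked R (xs ∷ʳ y ∷ʳ z) → Linked R (xs ∷ʳ y) × R y z
  Linked-∷ʳ⁻ []           (r ∷ [-]) = [-] , r
  Linked-∷ʳ⁻ (x ∷ [])     (r ∷ l)   = map₁ (r ∷_) (Linked-∷ʳ⁻ [] l)
  Linked-∷ʳ⁻ (x ∷ w ∷ ws) (r ∷ l)   = map₁ (r ∷_) (Linked-∷ʳ⁻ (w ∷ ws) l)

  Linked-∷ʳ⁺ : ∀ xs {y z} → Linked R (xs ∷ʳ y) → R y z → Linked R (xs ∷ʳ y ∷ʳ z)
  Linked-∷ʳ⁺ []           [-]     r = r ∷ [-]
  Linked-∷ʳ⁺ (x ∷ [])     (q ∷ l) r = q ∷ Linked-∷ʳ⁺ [] l r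
  Linked-∷ʳ⁺ (x ∷ w ∷ ws) (q ∷ l) r = q ∷ Linked-∷ʳ⁺ (w ∷ ws) l r

Unique-∷ʳ⇒head≢last : ∀ {A : Set} {x : A} xs {y} → Unique (x ∷ xs ∷ʳ y) → x ≢ y
Unique-∷ʳ⇒head≢last xs (x∉ ∷ _) = All.lookup x∉ (∈-++⁺ʳ xs (here refl))

∷ʳ-rotate : ∀ {A : Set} (xs : List A) y → xs ∷ʳ y ↭ y ∷ xs
∷ʳ-rotate xs y = ↭-sym (∷↭∷ʳ y xs)

module _ {n : ℕ} (G : SignedGraph n) where
  open SignedGraph G

  ∈N-sym : ∀ {x y} → _∈N[_] G y x → _∈N[_] G x y
  ∈N-sym (inj₁ y≡x) = inj₁ (sym y≡x)
  ∈N-sym (inj₂ xy)  = inj₂ (Adj-sym xy)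

  pathSign-∷ʳ : ∀ xs y z → pathSign G (xs ∷ʳ y ∷ʳ z) ≡ pathSign G (xs ∷ʳ y) · sign y z
  pathSign-∷ʳ []           y z = ·-identityʳ (sign y z)
  pathSign-∷ʳ (x ∷ [])     y z =
    trans (cong (sign x y ·_) (pathSign-∷ʳ [] y z)) (sym (·-assoc (sign x y) pos (sign y z)))
  pathSign-∷ʳ (x ∷ w ∷ ws) y z =
    trans (cong (sign x w ·_) (pathSign-∷ʳ (w ∷ ws) y z))
          (sym (·-assoc (sign x w) (pathSign G (w ∷ ws ∷ʳ y)) (sign y z)))

  closingEdge : ∀ x xs z → IsCycle G (x ∷ xs ∷ʳ z) → Adj z x
  closingEdge x xs z (_ , _ , linked) = proj₂ (Linked-∷ʳ⁻ (x ∷ xs) linked)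

  rotate-isCycle : ∀ x xs y → IsCycle G ((x ∷ xs) ∷ʳ y) → IsCycle G (y ∷ x ∷ xs)
  rotate-isCycle x xs y (len , uniq , linked) =
    subst (3 ≤_) (↭-length rotation) len ,
    Unique-resp-↭ (setoid (Fin n)) (↭⇒↭ₛ rotation) uniq ,
    proj₂ path ∷ proj₁ path
    where
    rotation : (x ∷ xs) ∷ʳ y ↭ y ∷ x ∷ xs
    rotation = ∷ʳ-rotate (x ∷ xs) y
    path : Linked Adj ((x ∷ xs) ∷ʳ y) × Adj y x
    path = Linked-∷ʳ⁻ (x ∷ xs) linked

  rotate-cycleSign : ∀ x xs y → cycleSign G ((x ∷ xs) ∷ʳ y) ≡ cycleSign G (y ∷ x ∷ xs)
  rotate-cycleSign x xs y =
    trans (pathSign-∷ʳ (x ∷ xs) y x) (·-comm (pathSign G ((x ∷ xs) ∷ʳ y)) (sign y x))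

  rotate-minUnbalancedCycle : ∀ x xs y →
    MinUnbalancedCycle G ((x ∷ xs) ∷ʳ y) → MinUnbalancedCycle G (y ∷ x ∷ xs)
  rotate-minUnbalancedCycle x xs y ((cycle , unbalanced) , minimal) =
    (rotate-isCycle x xs y cycle , trans (sym (rotate-cycleSign x xs y)) unbalanced) ,
    λ D D-unbalanced → subst (_≤ length D) (↭-length (∷ʳ-rotate (x ∷ xs) y)) (minimal D D-unbalanced)

  cut-triangle : ∀ x y R z → IsCycle G (x ∷ y ∷ R ∷ʳ z) → Adj y z → IsCycle G (x ∷ y ∷ z ∷ [])
  cut-triangle x y R z cycle@(_ , uniq@(x∉ ∷ y-uniq) , xy ∷ _) yz =
    ≤-refl ,
    ((All.head x∉ ∷ Unique-∷ʳ⇒head≢last (y ∷ R) uniq ∷ []) ∷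
     (Unique-∷ʳ⇒head≢last R y-uniq ∷ []) ∷ [] ∷ []) ,
    xy ∷ yz ∷ closingEdge x (y ∷ R) z cycle ∷ [-]

  cut-isCycle : ∀ x y w R z → IsCycle G (x ∷ y ∷ w ∷ R ∷ʳ z) → Adj y z → IsCycle G (y ∷ w ∷ R ∷ʳ z)
  cut-isCycle x y w R z (_ , _ ∷ uniq , _ ∷ linked) yz =
    s≤s (s≤s (subst (1 ≤_) (sym (length-++ R)) (m≤n+m 1 (length R)))) ,
    uniq ,
    Linked-∷ʳ⁺ (y ∷ w ∷ R) (proj₁ (Linked-∷ʳ⁻ (y ∷ w ∷ R) linked)) (Adj-sym yz)

  cut-cycleSign : ∀ x y R z →
    cycleSign G (x ∷ y ∷ R ∷ʳ z) ≡ cycleSign G (x ∷ y ∷ z ∷ []) · cycleSign G (y ∷ R ∷ʳ z)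
  cut-cycleSign x y R z = begin
    sign x y · pathSign G ((y ∷ R) ∷ʳ z ∷ʳ x)
      ≡⟨ cong (sign x y ·_) (pathSign-∷ʳ (y ∷ R) z x) ⟩
    sign x y · (p · sign z x)
      ≡⟨ ·-triangle (sign x y) (sign y z) (sign z x) p ⟩
    (sign x y · (sign y z · sign z x)) · (p · sign y z)
      ≡⟨ cong₂ (λ c b → (sign x y · (sign y z · c)) · (p · b)) (sym (·-identityʳ (sign z x))) (sign-sym y z) ⟩
    (sign x y · (sign y z · (sign z x · pos))) · (p · sign z y)
      ≡⟨ cong (cycleSign G (x ∷ y ∷ z ∷ []) ·_) (sym (pathSign-∷ʳ (y ∷ R) z y)) ⟩
    cycleSign G (x ∷ y ∷ z ∷ []) · cycleSign G (y ∷ R ∷ʳ z) ∎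
    where
    open ≡-Reasoning
    p : Sign
    p = pathSign G ((y ∷ R) ∷ʳ z)

  minUnbalancedCycle-noCutChord : C3⁻-free G → ∀ x y R z →
    MinUnbalancedCycle G (x ∷ y ∷ R ∷ʳ z) → ¬ _∈N[_] G z y
  minUnbalancedCycle-noCutChord c3 x y R z (((_ , _ ∷ y-uniq , _) , _) , _) (inj₁ z≡y) =
    Unique-∷ʳ⇒head≢last R y-uniq (sym z≡y)
  minUnbalancedCycle-noCutChord c3 x y [] z ((cycle , unbalanced) , _) (inj₂ _)
    with () ← trans (sym unbalanced) (c3 _ cycle refl)
  minUnbalancedCycle-noCutChord c3 x y (w ∷ R) z ((cycle , unbalanced) , minimal) (inj₂ yz) =
    1+n≰n (minimal D (cut-isCycle x y w R z cycle yz , D-unbalanced))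
    where
    open ≡-Reasoning
    D : List (Fin n)
    D = y ∷ w ∷ R ∷ʳ z
    D-unbalanced : cycleSign G D ≡ neg
    D-unbalanced = begin
      cycleSign G D                                      ≡⟨⟩
      pos · cycleSign G D                                ≡⟨ cong (_· cycleSign G D) (sym triangle-positive) ⟩
      cycleSign G (x ∷ y ∷ z ∷ []) · cycleSign G D       ≡⟨ sym (cut-cycleSign x y (w ∷ R) z) ⟩
      cycleSign G (x ∷ y ∷ w ∷ R ∷ʳ z)                   ≡⟨ unbalanced ⟩
      neg                                                ∎
      where
      triangle-positive : cycleSign G (x ∷ y ∷ z ∷ []) ≡ pos
      triangle-positive = c3 _ (cut-triangle x y (w ∷ R) z cycle yz) refl

lemma2p2 : {n : ℕ} (G : SignedGraph n) → Connected G → Unbalanced G → C3⁻-free G →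
    (u v uᵢ vⱼ : Fin n) (P₁ P₂ : List (Fin n)) → uᵢ ∷ P₁ ≡ P₂ ∷ʳ vⱼ →
    MinUnbalancedCycle G (u ∷ ((uᵢ ∷ P₁) ∷ʳ v)) →
    SignedGraph.sign G u v ≡ neg →
    (_∈N[_] G uᵢ u × ¬ _∈N[_] G uᵢ v) × (_∈N[_] G vⱼ v × ¬ _∈N[_] G vⱼ u)
lemma2p2 G _ _ c3 u v uᵢ vⱼ P₁ P₂ uᵢP₁≡P₂vⱼ 𝒞@(((_ , _ , uuᵢ ∷ _) , _) , _) _ =
  (inj₂ uuᵢ , minUnbalancedCycle-noCutChord G c3 u uᵢ P₁ v 𝒞 ∘ ∈N-sym G) ,
  (inj₂ (SignedGraph.Adj-sym G (closingEdge G v (u ∷ P₂) vⱼ (proj₁ (proj₁ 𝒞′)))) ,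
   minUnbalancedCycle-noCutChord G c3 v u P₂ vⱼ 𝒞′)
  where
  𝒞′ : MinUnbalancedCycle G (v ∷ u ∷ P₂ ∷ʳ vⱼ)
  𝒞′ = subst (λ Q → MinUnbalancedCycle G (v ∷ u ∷ Q)) uᵢP₁≡P₂vⱼ
         (rotate-minUnbalancedCycle G u (uᵢ ∷ P₁) v 𝒞)
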